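{- Let $P=([n],\preceq)$ be a poset, $0\le r<n$, and $V\in\mathcal{I}_P^{r+1}$. Let $W(V)=[n]\setminus{>}\max(V){<}$. Then the following conditions are equivalent: (a) every $I\in\mathcal{I}_P^r$ contains at least one element of $\max(V)$; (b) $|W(V)|<r$. Moreover, if these conditions hold, then no $r$-perfect $P$-codes exist.
   Context: $[n]=\{1,\dots,n\}$; subsets of $[n]$ are identified with their characteristic vectors in $F^n=\{0,1\}^n$, and $x+y$ is the symmetric difference. An ideal of $P$ is a set $I\subseteq[n]$ such that $a\in I$ and $b\preceq a$ imply $b\in I$; ${<}X{>}$ is the smallest ideal containing $X$ and ${>}X{<}$ is the smallest upset (set closed under going up) containing $X$. $\max(V)$ is the set of maximal elements of $V$. $\mathcal{I}_P^r$ is the set of ideals of cardinality $r$. The $P$-weight is $w_P(x)=|{<}x{>}|$ and $\mathcal{B}_P^r=\{x\in F^n: w_P(x)\le r\}$. A $P$-code $\mathcal{C}\subseteq F^n$ is $r$-perfect if every $x\in F^n$ has exactly one representation $x=c+b$ with $c\in\mathcal{C}$, $b\in\mathcal{B}_P^r$. -}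

module Defs where

open import Data.Nat using (ℕ; _≤_; _<_; suc)
open import Data.Bool using (Bool; _xor_)
open import Data.Fin using (Fin)
open import Data.Fin.Subset using (Subset; _∈_; ∣_∣; ∁)
open import Data.Fin.Subset.Properties using (_∈?_)
open import Data.Fin.Properties using (any?; all?)
open import Data.Vec using (tabulate; zipWith)
open import Data.Product using (_×_; ∃; Σ)
open import Relation.Binary.PropositionalEquality using (_≡_)
open import Relation.Binary.Structures using (IsDecPartialOrder)
open import Relation.Nullary using (does; _×-dec_; _→-dec_)
open import Level using (0ℓ)

record FinPoset (n : ℕ) : Set₁ where
  field
    _≼_ : Fin n → Fin n → Set
    isDecPartialOrder : IsDecPartialOrder _≡_ _≼_
  open IsDecPartialOrder isDecPartialOrder public using (_≤?_; _≟_)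

module _ {n : ℕ} (P : FinPoset n) where
  open FinPoset P

  IsIdeal : Subset n → Set
  IsIdeal I = ∀ a b → a ∈ I → b ≼ a → b ∈ I

  IsIdealOfSize : ℕ → Subset n → Set
  IsIdealOfSize r I = IsIdeal I × ∣ I ∣ ≡ r

  downClosure : Subset n → Subset n
  downClosure X = tabulate λ a → does (any? λ b → (b ∈? X) ×-dec (a ≤? b))

  upClosure : Subset n → Subset n
  upClosure X = tabulate λ a → does (any? λ b → (b ∈? X) ×-dec (b ≤? a))

  maxSet : Subset n → Subset n
  maxSet V = tabulate λ a →
    does ((a ∈? V) ×-dec all? (λ b → (b ∈? V) →-dec ((a ≤? b) →-dec (b ≟ a))))

  W : Subset n → Subset n
  W V = ∁ (upClosure (maxSet V))

  wP : Subset n → ℕ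
  wP x = ∣ downClosure x ∣

  InBall : ℕ → Subset n → Set
  InBall r x = wP x ≤ r

-- x + y : symmetric difference (addition in F^n)
_⊕_ : ∀ {n} → Subset n → Subset n → Subset n
x ⊕ y = zipWith _xor_ x y

module _ {n : ℕ} (P : FinPoset n) where
  IsPerfect : ℕ → (Subset n → Set) → Set
  IsPerfect r C =
    ∀ x → ∃ (λ c → ∃ λ b → C c × InBall P r b × x ≡ c ⊕ b)
        × (∀ c b c' b' → C c → InBall P r b → x ≡ c ⊕ b
                       → C c' → InBall P r b' → x ≡ c' ⊕ b'
                       → c ≡ c' × b ≡ b')

-- The key observation is that condition (a) makes sense for an arbitrary set X in place of
-- max(V): an ideal misses X exactly when it lies in the complement of the up-set >X<, and that
-- complement is itself an ideal. Since every ideal contains ideals of all smaller sizes (peel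
-- off maximal elements one at a time), X meets every r-ideal iff |[n] \ >X<| < r.
--
-- For the non-existence of perfect codes, let c₀ be any codeword and write c₀ + V = c + b with
-- w_P(b) ≤ r. Extend <b> to an r-ideal I; by (a) it contains some m ∈ max(V). Then V - m and
-- I are r-ideals, so c₀ + (V + {m}) = c + (b + {m}) are two decompositions of one word with
-- summands in the r-ball. Perfectness forces c₀ = c, hence V = b, contradicting
-- w_P(b) ≤ r < r + 1 = |V|.
module Submission where

open import Defs
open import Data.Nat using (ℕ; zero; suc; _<_; _≤_; _+_; z≤n; s≤s; _<?_)
open import Data.Nat.Properties
  using (<⇒≤; <⇒≱; ≮⇒≥; m≤n+m; m∸n+n≡m; ≤-trans; ≤-<-trans; suc-injective; n≮n)
open import Data.Fin using (Fin)
open import Data.Fin.Subset using (Subset; _∈_; _∉_; _⊆_; ∣_∣; ∁; ⊤; ⊥; ⁅_⁆; _─_; _-_; inside; outside)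
open import Data.Fin.Subset.Properties
  using (_∈?_; drop-there; p⊆q⇒∣p∣≤∣q∣; ∈⊤; ⊆⊤; ∣⊤∣≡n; x∈⁅x⁆; x∈⁅y⁆⇒x≡y; x∈p∧x∉q⇒x∈p─q;
         x∈p∧x≢y⇒x∈p-y; p─q⊆p; p─⊥≡p; ∣⊥∣≡0; x∉p⇒x∈∁p; x∈∁p⇒x∉p; ∉⊥; ⊆-min)
open import Data.Fin.Properties using (any?; all?)
open import Data.Fin.Induction using (po-noetherian)
open import Data.Vec using (_∷_; tabulate; map; here; there)
open import Data.Vec.Properties
  using (lookup∘tabulate; []=⇒lookup; lookup⇒[]=; zipWith-assoc; zipWith-identityˡ; zipWith-inverseˡ; map-id)
open import Data.Bool using (true)
open import Data.Bool.Properties using (xor-assoc; xor-identityˡ; xor-same)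
open import Data.Product using (_×_; ∃; _,_; proj₁; proj₂)
import Data.Product as Product
open import Data.Sum using (_⊎_; inj₁; inj₂)
import Data.Sum as Sum
open import Data.Empty using (⊥-elim)
open import Function using (_∘_; id; flip)
open import Function.Bundles using (_⇔_; mk⇔; Equivalence)
open import Induction.WellFounded using (Acc; acc)
open import Relation.Nullary using (¬_; Dec; yes; no; does; _×-dec_; _→-dec_; ¬?)
open import Relation.Nullary.Decidable using (dec-true; decidable-stable)
open import Relation.Binary.PropositionalEquality
  using (_≡_; _≢_; refl; sym; trans; cong; subst; module ≡-Reasoning)
open import Relation.Binary.Structures using (IsDecPartialOrder)
import Relation.Binary.Construct.NonStrictToStrict as ToStrict

open Equivalence using (to; from)

private
  variable
    n : ℕ

∈-tabulate-does : ∀ {Q : Fin n → Set} (Q? : ∀ a → Dec (Q a)) {x} →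
                  x ∈ tabulate (λ a → does (Q? a)) ⇔ Q x
∈-tabulate-does Q? {x} = mk⇔
  (λ x∈ → does-true⇒ (Q? x) (trans (sym (lookup∘tabulate _ x)) ([]=⇒lookup x∈)))
  (λ q → lookup⇒[]= x _ (trans (lookup∘tabulate _ x) (dec-true (Q? x) q)))
  where
  does-true⇒ : ∀ {A : Set} (a? : Dec A) → does a? ≡ true → A
  does-true⇒ (yes a) _ = a

⁅x⁆⊆p : ∀ {p : Subset n} {x} → x ∈ p → ⁅ x ⁆ ⊆ p
⁅x⁆⊆p {p = p} {x} x∈p y∈⁅x⁆ = subst (_∈ p) (sym (x∈⁅y⁆⇒x≡y x y∈⁅x⁆)) x∈p

x∈p─q⇒x∉q : ∀ (p q : Subset n) {x} → x ∈ p ─ q → x ∉ q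
x∈p─q⇒x∉q (_ ∷ p) (outside ∷ q) here ()
x∈p─q⇒x∉q (_ ∷ p) (_ ∷ q) (there x∈) (there x∈q) = x∈p─q⇒x∉q p q x∈ x∈q

x∈p⇒suc∣p-x∣≡∣p∣ : ∀ {p : Subset n} {x} → x ∈ p → suc ∣ p - x ∣ ≡ ∣ p ∣
x∈p⇒suc∣p-x∣≡∣p∣ {p = inside ∷ p} here = cong (suc ∘ ∣_∣) (p─⊥≡p p)
x∈p⇒suc∣p-x∣≡∣p∣ {p = inside ∷ p} (there x∈p) = cong suc (x∈p⇒suc∣p-x∣≡∣p∣ x∈p)
x∈p⇒suc∣p-x∣≡∣p∣ {p = outside ∷ p} (there x∈p) = x∈p⇒suc∣p-x∣≡∣p∣ x∈p

∣p∣<∣q∣⇒∃x∈q∧x∉p : ∀ {p q : Subset n} → ∣ p ∣ < ∣ q ∣ → ∃ λ x → x ∈ q × x ∉ p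
∣p∣<∣q∣⇒∃x∈q∧x∉p {p = p} {q} ∣p∣<∣q∣ with any? (λ x → (x ∈? q) ×-dec ¬? (x ∈? p))
... | yes witness = witness
... | no ∄x = ⊥-elim (<⇒≱ ∣p∣<∣q∣ (p⊆q⇒∣p∣≤∣q∣ q⊆p))
  where
  q⊆p : q ⊆ p
  q⊆p {x} x∈q = decidable-stable (x ∈? p) (λ x∉p → ∄x (x , x∈q , x∉p))

⊕-assoc : ∀ (p q s : Subset n) → (p ⊕ q) ⊕ s ≡ p ⊕ (q ⊕ s)
⊕-assoc = zipWith-assoc xor-assoc

⊕-involutiveˡ : ∀ (p q : Subset n) → p ⊕ (p ⊕ q) ≡ q
⊕-involutiveˡ p q = begin
  p ⊕ (p ⊕ q)         ≡⟨ ⊕-assoc p p q ⟨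
  (p ⊕ p) ⊕ q         ≡⟨ cong (λ s → (s ⊕ p) ⊕ q) (map-id p) ⟨
  (map id p ⊕ p) ⊕ q  ≡⟨ cong (_⊕ q) (zipWith-inverseˡ xor-same p) ⟩
  ⊥ ⊕ q               ≡⟨ zipWith-identityˡ xor-identityˡ q ⟩
  q                   ∎
  where open ≡-Reasoning

⊕-cancelˡ : ∀ (p : Subset n) {q s} → p ⊕ q ≡ p ⊕ s → q ≡ s
⊕-cancelˡ p {q} {s} eq = begin
  q            ≡⟨ ⊕-involutiveˡ p q ⟨
  p ⊕ (p ⊕ q)  ≡⟨ cong (p ⊕_) eq ⟩
  p ⊕ (p ⊕ s)  ≡⟨ ⊕-involutiveˡ p s ⟩
  s            ∎
  where open ≡-Reasoning

x∈p⊕q⁻ : ∀ (p q : Subset n) {x} → x ∈ p ⊕ q → (x ∈ p × x ∉ q) ⊎ (x ∉ p × x ∈ q)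
x∈p⊕q⁻ (inside ∷ p) (outside ∷ q) here = inj₁ (here , λ ())
x∈p⊕q⁻ (outside ∷ p) (inside ∷ q) here = inj₂ ((λ ()) , here)
x∈p⊕q⁻ (_ ∷ p) (_ ∷ q) (there x∈) =
  Sum.map (Product.map there (_∘ drop-there)) (Product.map (_∘ drop-there) there) (x∈p⊕q⁻ p q x∈)

q⊆p⇒p⊕q⊆p─q : ∀ {p q : Subset n} → q ⊆ p → p ⊕ q ⊆ p ─ q
q⊆p⇒p⊕q⊆p─q {p = p} {q} q⊆p x∈ with x∈p⊕q⁻ p q x∈
... | inj₁ (x∈p , x∉q) = x∈p∧x∉q⇒x∈p─q x∈p x∉q
... | inj₂ (x∉p , x∈q) = ⊥-elim (x∉p (q⊆p x∈q))

module _ {n : ℕ} (P : FinPoset n) where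
  open FinPoset P
  open IsDecPartialOrder isDecPartialOrder
    using (isPartialOrder) renaming (refl to ≼-refl; trans to ≼-trans)

  ∈-upClosure : ∀ {X a} → a ∈ upClosure P X ⇔ (∃ λ b → b ∈ X × b ≼ a)
  ∈-upClosure {X} = ∈-tabulate-does (λ a → any? λ b → (b ∈? X) ×-dec (b ≤? a))

  ∈-downClosure : ∀ {X a} → a ∈ downClosure P X ⇔ (∃ λ b → b ∈ X × a ≼ b)
  ∈-downClosure {X} = ∈-tabulate-does (λ a → any? λ b → (b ∈? X) ×-dec (a ≤? b))

  ∈-maxSet : ∀ {S a} → a ∈ maxSet P S ⇔ (a ∈ S × ∀ b → b ∈ S → a ≼ b → b ≡ a)
  ∈-maxSet {S} = ∈-tabulate-does (λ a →
    (a ∈? S) ×-dec all? (λ b → (b ∈? S) →-dec ((a ≤? b) →-dec (b ≟ a))))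

  maxSet⊆ : ∀ {S} → maxSet P S ⊆ S
  maxSet⊆ = proj₁ ∘ to ∈-maxSet

  downClosure-isIdeal : ∀ X → IsIdeal P (downClosure P X)
  downClosure-isIdeal X a b a∈ b≼a =
    let (c , c∈X , a≼c) = to ∈-downClosure a∈ in from ∈-downClosure (c , c∈X , ≼-trans b≼a a≼c)

  ⊆-downClosure : ∀ {X} → X ⊆ downClosure P X
  ⊆-downClosure x∈X = from ∈-downClosure (_ , x∈X , ≼-refl)

  downClosure-least : ∀ {X I} → IsIdeal P I → X ⊆ I → downClosure P X ⊆ I
  downClosure-least {I = I} I-ideal X⊆I a∈ =
    let (c , c∈X , a≼c) = to ∈-downClosure a∈ in I-ideal c _ (X⊆I c∈X) a≼c

  ⊆-idealOfSize⇒InBall : ∀ {r X I} → IsIdealOfSize P r I → X ⊆ I → InBall P r X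
  ⊆-idealOfSize⇒InBall (I-ideal , ∣I∣≡r) X⊆I =
    subst (_ ≤_) ∣I∣≡r (p⊆q⇒∣p∣≤∣q∣ (downClosure-least I-ideal X⊆I))

  InBall⇒∣X∣≤r : ∀ {r X} → InBall P r X → ∣ X ∣ ≤ r
  InBall⇒∣X∣≤r = ≤-trans (p⊆q⇒∣p∣≤∣q∣ ⊆-downClosure)

  ∁upClosure-isIdeal : ∀ X → IsIdeal P (∁ (upClosure P X))
  ∁upClosure-isIdeal X a b a∈ b≼a = x∉p⇒x∈∁p λ b∈ →
    let (c , c∈X , c≼b) = to ∈-upClosure b∈
    in x∈∁p⇒x∉p a∈ (from ∈-upClosure (c , c∈X , ≼-trans c≼b b≼a))

  ideal-disjoint⇒⊆∁upClosure : ∀ {X I} → IsIdeal P I → (∀ {a} → a ∈ X → a ∉ I) →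
                               I ⊆ ∁ (upClosure P X)
  ideal-disjoint⇒⊆∁upClosure I-ideal disjoint {x} x∈I = x∉p⇒x∈∁p λ x∈ →
    let (c , c∈X , c≼x) = to ∈-upClosure x∈ in disjoint c∈X (I-ideal x c x∈I c≼x)

  ∃-maximal : ∀ {S a} → a ∈ S → ∃ λ m → m ∈ maxSet P S
  ∃-maximal {S} = climb (po-noetherian isPartialOrder _)
    where
    climb : ∀ {a} → Acc (flip (ToStrict._<_ _≡_ _≼_)) a → a ∈ S → ∃ λ m → m ∈ maxSet P S
    climb {a} (acc above) a∈S with any? (λ b → (b ∈? S) ×-dec ((a ≤? b) ×-dec ¬? (a ≟ b)))
    ... | yes (b , b∈S , a≼b , a≢b) = climb (above (a≼b , a≢b)) b∈S
    ... | no ∄b = a , from ∈-maxSet (a∈S , λ b b∈S a≼b →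
                        decidable-stable (b ≟ a) λ b≢a → ∄b (b , b∈S , a≼b , b≢a ∘ sym))

  remove-maximal-isIdeal : ∀ {K m} → IsIdeal P K → m ∈ maxSet P K → IsIdeal P (K - m)
  remove-maximal-isIdeal {K} {m} K-ideal m∈max a b a∈K-m b≼a =
    x∈p∧x≢y⇒x∈p-y (K-ideal a b a∈K b≼a) b≢m
    where
    a∈K : a ∈ K
    a∈K = p─q⊆p K ⁅ m ⁆ a∈K-m
    b≢m : b ≢ m
    b≢m refl = x∈p─q⇒x∉q K ⁅ m ⁆ a∈K-m
                 (subst (_∈ ⁅ m ⁆) (sym (proj₂ (to ∈-maxSet m∈max) a a∈K b≼a)) (x∈⁅x⁆ m))

  ∃-maximal-outside : ∀ {J K x} → IsIdeal P J → x ∈ K → x ∉ J → ∃ λ m → m ∈ maxSet P K × m ∉ J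
  ∃-maximal-outside {J} {K} J-ideal x∈K x∉J with ∃-maximal (x∈p∧x∉q⇒x∈p─q x∈K x∉J)
  ... | m , m∈max with to ∈-maxSet m∈max
  ...   | m∈K─J , maximal =
    m , from ∈-maxSet (m∈K , λ b b∈K m≼b → maximal b (x∈p∧x∉q⇒x∈p─q b∈K (b∉J m≼b)) m≼b) , m∉J
    where
    m∈K : m ∈ K
    m∈K = p─q⊆p K J m∈K─J
    m∉J : m ∉ J
    m∉J = x∈p─q⇒x∉q K J m∈K─J
    b∉J : ∀ {b} → m ≼ b → b ∉ J
    b∉J m≼b b∈J = m∉J (J-ideal _ m b∈J m≼b)

  ∃-ideal-one-smaller : ∀ {J K} → IsIdeal P J → IsIdeal P K → J ⊆ K → ∣ J ∣ < ∣ K ∣ →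
                        ∃ λ K′ → IsIdeal P K′ × J ⊆ K′ × K′ ⊆ K × suc ∣ K′ ∣ ≡ ∣ K ∣
  ∃-ideal-one-smaller {J} {K} J-ideal K-ideal J⊆K ∣J∣<∣K∣ with ∣p∣<∣q∣⇒∃x∈q∧x∉p ∣J∣<∣K∣
  ... | x , x∈K , x∉J with ∃-maximal-outside J-ideal x∈K x∉J
  ...   | m , m∈max , m∉J =
    K - m , remove-maximal-isIdeal K-ideal m∈max , J⊆K-m , p─q⊆p K ⁅ m ⁆ ,
    x∈p⇒suc∣p-x∣≡∣p∣ (maxSet⊆ m∈max)
    where
    J⊆K-m : J ⊆ K - m
    J⊆K-m y∈J = x∈p∧x≢y⇒x∈p-y (J⊆K y∈J) λ y≡m → m∉J (subst (_∈ J) y≡m y∈J)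

  ∃-ideal-between : ∀ {r J K} → IsIdeal P J → IsIdeal P K → J ⊆ K → ∣ J ∣ ≤ r → r ≤ ∣ K ∣ →
                    ∃ λ I → IsIdealOfSize P r I × J ⊆ I × I ⊆ K
  ∃-ideal-between {r} {J} J-ideal K-ideal J⊆K ∣J∣≤r r≤∣K∣ =
    shrink _ K-ideal J⊆K (sym (m∸n+n≡m r≤∣K∣))
    where
    shrink : ∀ d {K} → IsIdeal P K → J ⊆ K → ∣ K ∣ ≡ d + r →
             ∃ λ I → IsIdealOfSize P r I × J ⊆ I × I ⊆ K
    shrink zero {K} K-ideal J⊆K ∣K∣≡r = K , (K-ideal , ∣K∣≡r) , J⊆K , id
    shrink (suc d) {K} K-ideal J⊆K ∣K∣≡ =
      let (K′ , K′-ideal , J⊆K′ , K′⊆K , ∣K′∣≡) = ∃-ideal-one-smaller J-ideal K-ideal J⊆K ∣J∣<∣K∣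
          (I , I-ideal , J⊆I , I⊆K′) = shrink d K′-ideal J⊆K′ (suc-injective (trans ∣K′∣≡ ∣K∣≡))
      in I , I-ideal , J⊆I , K′⊆K ∘ I⊆K′
      where
      ∣J∣<∣K∣ : ∣ J ∣ < ∣ K ∣
      ∣J∣<∣K∣ = ≤-<-trans ∣J∣≤r (subst (r <_) (sym ∣K∣≡) (s≤s (m≤n+m r d)))

  HitsIdealsOfSize : ℕ → Subset n → Set
  HitsIdealsOfSize r X = ∀ I → IsIdealOfSize P r I → ∃ λ a → a ∈ X × a ∈ I

  hits⇔∣∁upClosure∣< : ∀ r X → HitsIdealsOfSize r X ⇔ ∣ ∁ (upClosure P X) ∣ < r
  hits⇔∣∁upClosure∣< r X = mk⇔ hits⇒ ⇒hits
    where
    hits⇒ : HitsIdealsOfSize r X → ∣ ∁ (upClosure P X) ∣ < r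
    hits⇒ hits = decidable-stable (_ <? r) λ ≮r →
      let (I , I-sized , _ , I⊆∁U) = ∃-ideal-between (λ _ _ a∈⊥ _ → ⊥-elim (∉⊥ a∈⊥))
                                       (∁upClosure-isIdeal X) (⊆-min _)
                                       (subst (_≤ r) (sym (∣⊥∣≡0 n)) z≤n) (≮⇒≥ ≮r)
          (a , a∈X , a∈I) = hits I I-sized
      in x∈∁p⇒x∉p (I⊆∁U a∈I) (from ∈-upClosure (a , a∈X , ≼-refl))
    ⇒hits : ∣ ∁ (upClosure P X) ∣ < r → HitsIdealsOfSize r X
    ⇒hits ∣∁U∣<r I (I-ideal , ∣I∣≡r) =
      decidable-stable (any? λ a → (a ∈? X) ×-dec (a ∈? I)) λ ∄a →
        <⇒≱ ∣∁U∣<r (subst (_≤ _) ∣I∣≡r (p⊆q⇒∣p∣≤∣q∣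
          (ideal-disjoint⇒⊆∁upClosure I-ideal λ a∈X a∈I → ∄a (_ , a∈X , a∈I))))

  remove-maximal-isIdealOfSize : ∀ {r V m} → IsIdealOfSize P (suc r) V → m ∈ maxSet P V →
                                 IsIdealOfSize P r (V - m)
  remove-maximal-isIdealOfSize (V-ideal , ∣V∣≡) m∈max =
    remove-maximal-isIdeal V-ideal m∈max ,
    suc-injective (trans (x∈p⇒suc∣p-x∣≡∣p∣ (maxSet⊆ m∈max)) ∣V∣≡)

  ⊕⁅⁆-InBall : ∀ {r X I m} → IsIdealOfSize P r I → X ⊆ I → m ∈ I → InBall P r (X ⊕ ⁅ m ⁆)
  ⊕⁅⁆-InBall {X = X} {I} {m} I-sized X⊆I m∈I = ⊆-idealOfSize⇒InBall I-sized λ y∈ →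
    Sum.[ X⊆I ∘ proj₁ , ⁅x⁆⊆p m∈I ∘ proj₂ ]′ (x∈p⊕q⁻ X ⁅ m ⁆ y∈)

  perfect-⊕-injective : ∀ {r C c c′ p q e} → IsPerfect P r C → C c → C c′ →
                        InBall P r (p ⊕ e) → InBall P r (q ⊕ e) → c ⊕ p ≡ c′ ⊕ q → p ≡ q
  perfect-⊕-injective {c = c} {c′} {p} {q} {e} perfect c∈C c′∈C p⊕e∈B q⊕e∈B c⊕p≡c′⊕q =
    ⊕-cancelˡ c (trans c⊕p≡c′⊕q (cong (_⊕ q) (sym c≡c′)))
    where
    shifted : c ⊕ (p ⊕ e) ≡ c′ ⊕ (q ⊕ e)
    shifted = begin
      c ⊕ (p ⊕ e)    ≡⟨ ⊕-assoc c p e ⟨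
      (c ⊕ p) ⊕ e    ≡⟨ cong (_⊕ e) c⊕p≡c′⊕q ⟩
      (c′ ⊕ q) ⊕ e   ≡⟨ ⊕-assoc c′ q e ⟩
      c′ ⊕ (q ⊕ e)   ∎
      where open ≡-Reasoning
    c≡c′ : c ≡ c′
    c≡c′ = proj₁ (proj₂ (perfect _) c _ c′ _ c∈C p⊕e∈B refl c′∈C q⊕e∈B shifted)

  hits-maxSet⇒¬perfect : ∀ {r V} → r < n → IsIdealOfSize P (suc r) V →
                         HitsIdealsOfSize r (maxSet P V) → ¬ ∃ (IsPerfect P r)
  hits-maxSet⇒¬perfect {r} {V} r<n V-sized hits (C , perfect) =
    -- only the existence of some codeword c₀ is taken from the decomposition of V
    let (c₀ , _ , c₀∈C , _) = proj₁ (perfect V)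
        (c , b , c∈C , b∈B , c₀⊕V≡c⊕b) = proj₁ (perfect (c₀ ⊕ V))
        (I , I-sized , ⟨b⟩⊆I , _) = ∃-ideal-between (downClosure-isIdeal b) (λ _ _ _ _ → ∈⊤) ⊆⊤ b∈B
                                      (subst (r ≤_) (sym (∣⊤∣≡n n)) (<⇒≤ r<n))
        (m , m∈max , m∈I) = hits I I-sized
        V≡b = perfect-⊕-injective perfect c₀∈C c∈C
                (⊆-idealOfSize⇒InBall (remove-maximal-isIdealOfSize V-sized m∈max)
                                      (q⊆p⇒p⊕q⊆p─q (⁅x⁆⊆p (maxSet⊆ m∈max))))
                (⊕⁅⁆-InBall I-sized (⟨b⟩⊆I ∘ ⊆-downClosure) m∈I)
                c₀⊕V≡c⊕b
    in n≮n r (subst (_≤ r) (proj₂ V-sized) (InBall⇒∣X∣≤r (subst (InBall P r) (sym V≡b) b∈B)))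

corollary3 : ∀ (n : ℕ) (P : FinPoset n) (r : ℕ) → r < n →
    (V : Subset n) → IsIdealOfSize P (suc r) V →
    ((∀ I → IsIdealOfSize P r I → ∃ λ a → a ∈ maxSet P V × a ∈ I)
       ⇔ (∣ W P V ∣ < r))
    × ((∀ I → IsIdealOfSize P r I → ∃ λ a → a ∈ maxSet P V × a ∈ I)
       → ¬ (∃ λ (C : Subset n → Set) → IsPerfect P r C))
corollary3 n P r r<n V V-sized =
  hits⇔∣∁upClosure∣< P r (maxSet P V) , hits-maxSet⇒¬perfect P r<n V-sized
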